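{- Let $\mu,\nu,q\in\mathbb{C}$ and let $X,Y$ satisfy $XY-qYX=\mu I+\nu Y$. Let $L_{\mu,\nu;q}(n;j,k)$ be the coefficient of $Y^jX^k$ in the normal ordered expansion of $(Y^2X)^n$, with $L_{\mu,\nu;q}(n;j,k)=0$ if $j<0$ or $k<0$. Then for all $n\ge0$, $j\ge2$, $k\ge0$, $$L_{\mu,\nu;q}(n+1;j,k)=q^{j-2}L_{\mu,\nu;q}(n;j-2,k-1)+\mu[j-1]_q\,L_{\mu,\nu;q}(n;j-1,k)+\nu[j-2]_q\,L_{\mu,\nu;q}(n;j-2,k).$$
   Context: The monomials $Y^jX^k$ form a basis of this algebra, so the coefficients are well defined. $[m]_q=1+q+\cdots+q^{m-1}$ for $m\ge1$ and $[0]_q=0$. -}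

module Defs where

open import Algebra.Bundles using (CommutativeRing)
open import Data.Nat using (ℕ; zero; suc; _≡ᵇ_) renaming (_+_ to _+ℕ_)
open import Data.Integer using (ℤ; +_; -[1+_])
open import Data.Bool using (if_then_else_; _∧_)
open import Data.List using (List; []; _∷_; _++_; map; concatMap; foldl; foldr; concat; replicate)
open import Data.Product using (_×_; _,_)

data Letter : Set where
  X Y : Letter

-- Everything is defined over a commutative ring R of scalars with
-- parameters μ ν q (the paper takes R = ℂ).
module Normal {c ℓ} (R : CommutativeRing c ℓ)
              (μ ν q : CommutativeRing.Carrier R) where
  open CommutativeRing R

  pow : Carrier → ℕ → Carrier
  pow x zero = 1#
  pow x (suc n) = x * pow x n

  qint : ℕ → Carrier
  qint zero = 0#
  qint (suc m) = qint m + pow q m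

  -- A normal-ordered element: formal linear combination of monomials
  -- Y^j X^k, represented by a list of terms (coefficient , j , k).
  Poly : Set c
  Poly = List (Carrier × ℕ × ℕ)

  scale : Carrier → Poly → Poly
  scale a = map (λ (b , j , k) → (a * b , j , k))

  mulX : Poly → Poly
  mulX = map (λ (b , j , k) → (b , j , suc k))

  shiftY : ℕ → Poly → Poly
  shiftY a = map (λ (b , j , k) → (b , a +ℕ j , k))

  -- normal ordered form of X^b Y, using XY = qYX + μ I + ν Y:
  -- X^(b+1) Y = q (X^b Y) X + μ X^b + ν X^b Y
  xPowY : ℕ → Poly
  xPowY zero = (1# , 1 , 0) ∷ []
  xPowY (suc b) = scale q (mulX (xPowY b)) ++ ((μ , 0 , b) ∷ []) ++ scale ν (xPowY b)

  -- right multiplication by Y : Y^j X^k Y = Y^j (X^k Y)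
  mulY : Poly → Poly
  mulY = concatMap (λ (b , j , k) → scale b (shiftY j (xPowY k)))

  step : Poly → Letter → Poly
  step p X = mulX p
  step p Y = mulY p

  nf : List Letter → Poly
  nf = foldl step ((1# , 0 , 0) ∷ [])

  coeff : Poly → ℕ → ℕ → Carrier
  coeff p j k = foldr (λ (b , j' , k') acc →
                  if (j' ≡ᵇ j) ∧ (k' ≡ᵇ k) then b + acc else acc) 0# p

  word : ℕ → List Letter
  word n = concat (replicate n (Y ∷ Y ∷ X ∷ []))

  L : ℕ → ℕ → ℕ → Carrier
  L n j k = coeff (nf (word n)) j k

  Lℤ : ℕ → ℤ → ℤ → Carrier
  Lℤ n (+ j) (+ k) = L n j k
  Lℤ n (+ j) -[1+ k ] = 0#
  Lℤ n -[1+ j ] k = 0#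

-- A family φ of scalars indexed by the monomials Y^j X^k pairs linearly with
-- normal-ordered elements, and multiplication by X or Y on either side has an
-- explicit transpose on such families. As (Y²X)^(n+1) = Y²X · (Y²X)^n, the
-- coefficient of Y^j X^k in it is the pairing of (Y²X)^n with the transpose of
-- left multiplication by Y²X applied to the dual basis vector at (j , k); that
-- transpose is computed from X Y^a = q^a Y^a X + μ [a]_q Y^(a-1) + ν [a]_q Y^a
-- and yields the three terms. Normal ordering multiplies only on the right, so
-- the pairing identity is carried along the word letter by letter, using that
-- left multiplication commutes with right multiplication.
module Submission where

open import Defs
open import Algebra.Bundles using (CommutativeRing)
open import Data.Nat using (ℕ; suc; _≤_; _∸_)
open import Data.Integer using (_⊖_)

open import Data.Nat using (zero; pred; s≤s; z≤n; _≡ᵇ_) renaming (_+_ to _+ℕ_)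
import Data.Nat.Properties as ℕ
open import Data.Integer using (ℤ; +_; -[1+_])
open import Data.Bool using (true; false; if_then_else_; _∧_; T)
open import Data.List using ([]; _∷_; _++_; foldl)
open import Data.Product using (_,_)
open import Level using (_⊔_)
open import Relation.Binary.PropositionalEquality as ≡ using (_≡_)

module NormalOrderingDuality {c ℓ} (R : CommutativeRing c ℓ)
                             (μ ν q : CommutativeRing.Carrier R) where
  open CommutativeRing R
  open Normal R μ ν q
  open import Algebra.Solver.Ring.NaturalCoefficients.Default commutativeSemiring
    using (solve; _:=_; _:+_; _:*_; con)
  open import Relation.Binary.Reasoning.Setoid setoid

  Functional : Set c
  Functional = ℕ → ℕ → Carrier

  ev : Functional → Poly → Carrier
  ev φ [] = 0#
  ev φ ((b , j , k) ∷ p) = b * φ j k + ev φ p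

  infix 4 _≈ᶠ_
  infixl 6 _+ᶠ_
  infixr 7 _*ᶠ_

  _≈ᶠ_ : Functional → Functional → Set ℓ
  φ ≈ᶠ ψ = ∀ j k → φ j k ≈ ψ j k

  0ᶠ : Functional
  0ᶠ _ _ = 0#

  _+ᶠ_ : Functional → Functional → Functional
  (φ +ᶠ ψ) j k = φ j k + ψ j k

  _*ᶠ_ : Carrier → Functional → Functional
  (a *ᶠ φ) j k = a * φ j k

  ev-cong : ∀ {φ ψ} → φ ≈ᶠ ψ → ∀ p → ev φ p ≈ ev ψ p
  ev-cong φ≈ψ [] = refl
  ev-cong φ≈ψ ((b , j , k) ∷ p) = +-cong (*-congˡ (φ≈ψ j k)) (ev-cong φ≈ψ p)

  ev-0ᶠ : ∀ p → ev 0ᶠ p ≈ 0#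
  ev-0ᶠ [] = refl
  ev-0ᶠ ((b , j , k) ∷ p) = trans (+-cong (zeroʳ b) (ev-0ᶠ p)) (+-identityˡ 0#)

  ev-+ᶠ : ∀ φ ψ p → ev (φ +ᶠ ψ) p ≈ ev φ p + ev ψ p
  ev-+ᶠ φ ψ [] = sym (+-identityˡ 0#)
  ev-+ᶠ φ ψ ((b , j , k) ∷ p) =
    trans (+-congˡ (ev-+ᶠ φ ψ p)) (expand b (φ j k) (ψ j k) (ev φ p) (ev ψ p))
    where
    expand : ∀ b x y s t → b * (x + y) + (s + t) ≈ (b * x + s) + (b * y + t)
    expand = solve 5 (λ b x y s t → b :* (x :+ y) :+ (s :+ t)
                                  := (b :* x :+ s) :+ (b :* y :+ t)) refl

  ev-*ᶠ : ∀ a φ p → ev (a *ᶠ φ) p ≈ a * ev φ p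
  ev-*ᶠ a φ [] = sym (zeroʳ a)
  ev-*ᶠ a φ ((b , j , k) ∷ p) = trans (+-congˡ (ev-*ᶠ a φ p)) (pull a b (φ j k) (ev φ p))
    where
    pull : ∀ a b x s → b * (a * x) + a * s ≈ a * (b * x + s)
    pull = solve 4 (λ a b x s → b :* (a :* x) :+ a :* s := a :* (b :* x :+ s)) refl

  ev-++ : ∀ φ p r → ev φ (p ++ r) ≈ ev φ p + ev φ r
  ev-++ φ [] r = sym (+-identityˡ _)
  ev-++ φ ((b , j , k) ∷ p) r = trans (+-congˡ (ev-++ φ p r)) (sym (+-assoc _ _ _))

  ev-scale : ∀ φ a p → ev φ (scale a p) ≈ a * ev φ p
  ev-scale φ a [] = sym (zeroʳ a)
  ev-scale φ a ((b , j , k) ∷ p) =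
    trans (+-cong (*-assoc a b (φ j k)) (ev-scale φ a p)) (sym (distribˡ a _ _))

  mulXᵀ : Functional → Functional
  mulXᵀ φ j k = φ j (suc k)

  ev-mulX : ∀ φ p → ev φ (mulX p) ≡ ev (mulXᵀ φ) p
  ev-mulX φ [] = ≡.refl
  ev-mulX φ ((b , j , k) ∷ p) = ≡.cong (_+_ (b * φ j (suc k))) (ev-mulX φ p)

  shiftYᵀ : ℕ → Functional → Functional
  shiftYᵀ a φ j k = φ (a +ℕ j) k

  ev-shiftY : ∀ φ a p → ev φ (shiftY a p) ≡ ev (shiftYᵀ a φ) p
  ev-shiftY φ a [] = ≡.refl
  ev-shiftY φ a ((b , j , k) ∷ p) = ≡.cong (_+_ (b * φ (a +ℕ j) k)) (ev-shiftY φ a p)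

  mulYᵀ : Functional → Functional
  mulYᵀ φ j k = ev (shiftYᵀ j φ) (xPowY k)

  ev-mulY : ∀ φ p → ev φ (mulY p) ≈ ev (mulYᵀ φ) p
  ev-mulY φ [] = refl
  ev-mulY φ ((b , j , k) ∷ p) = begin
    ev φ (scale b (shiftY j (xPowY k)) ++ mulY p)
      ≈⟨ ev-++ φ (scale b (shiftY j (xPowY k))) (mulY p) ⟩
    ev φ (scale b (shiftY j (xPowY k))) + ev φ (mulY p)
      ≈⟨ +-cong (ev-scale φ b (shiftY j (xPowY k))) (ev-mulY φ p) ⟩
    b * ev φ (shiftY j (xPowY k)) + ev (mulYᵀ φ) p
      ≡⟨ ≡.cong (λ t → b * t + ev (mulYᵀ φ) p) (ev-shiftY φ j (xPowY k)) ⟩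
    b * mulYᵀ φ j k + ev (mulYᵀ φ) p ∎

  -- Transpose of left multiplication by X, read off from
  -- X Y^j X^k = q^j Y^j X^(k+1) + μ [j]_q Y^(j-1) X^k + ν [j]_q Y^j X^k.
  lmulXᵀ : Functional → Functional
  lmulXᵀ ψ j k = pow q j * ψ j (suc k) + μ * qint j * ψ (pred j) k + ν * qint j * ψ j k

  ev-xPowY-step : ∀ χ l → ev χ (xPowY (suc l))
                  ≈ q * ev (mulXᵀ χ) (xPowY l) + (μ * χ 0 l + ν * ev χ (xPowY l))
  ev-xPowY-step χ l = begin
    ev χ (scale q (mulX (xPowY l)) ++ (μ , 0 , l) ∷ scale ν (xPowY l))
      ≈⟨ ev-++ χ (scale q (mulX (xPowY l))) ((μ , 0 , l) ∷ scale ν (xPowY l)) ⟩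
    ev χ (scale q (mulX (xPowY l))) + (μ * χ 0 l + ev χ (scale ν (xPowY l)))
      ≈⟨ +-cong (ev-scale χ q (mulX (xPowY l))) (+-congˡ (ev-scale χ ν (xPowY l))) ⟩
    q * ev χ (mulX (xPowY l)) + (μ * χ 0 l + ν * ev χ (xPowY l))
      ≡⟨ ≡.cong (λ t → q * t + (μ * χ 0 l + ν * ev χ (xPowY l))) (ev-mulX χ (xPowY l)) ⟩
    q * ev (mulXᵀ χ) (xPowY l) + (μ * χ 0 l + ν * ev χ (xPowY l)) ∎

  ev-xPowY-suc : ∀ l χ → ev χ (xPowY (suc l)) ≈ ev (lmulXᵀ χ) (xPowY l)
  ev-xPowY-suc zero χ =
    trans (ev-xPowY-step χ 0) (base q μ ν (χ 1 1) (χ 1 0) (χ 0 0))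
    where
    base : ∀ q μ ν x y z → q * (1# * x + 0#) + (μ * z + ν * (1# * y + 0#))
           ≈ 1# * (q * 1# * x + μ * (0# + 1#) * z + ν * (0# + 1#) * y) + 0#
    base = solve 6 (λ q μ ν x y z →
      q :* (con 1 :* x :+ con 0) :+ (μ :* z :+ ν :* (con 1 :* y :+ con 0))
      := con 1 :* (q :* con 1 :* x :+ μ :* (con 0 :+ con 1) :* z
                   :+ ν :* (con 0 :+ con 1) :* y) :+ con 0) refl
  ev-xPowY-suc (suc l) χ = begin
    ev χ (xPowY (suc (suc l)))
      ≈⟨ ev-xPowY-step χ (suc l) ⟩
    q * ev (mulXᵀ χ) (xPowY (suc l)) + (μ * χ 0 (suc l) + ν * ev χ (xPowY (suc l)))
      ≈⟨ +-cong (*-congˡ (ev-xPowY-suc l (mulXᵀ χ)))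
                (+-cong (*-congˡ (sym lmulXᵀ-at-0)) (*-congˡ (ev-xPowY-suc l χ))) ⟩
    q * ev (mulXᵀ (lmulXᵀ χ)) (xPowY l) + (μ * lmulXᵀ χ 0 l + ν * ev (lmulXᵀ χ) (xPowY l))
      ≈⟨ ev-xPowY-step (lmulXᵀ χ) l ⟨
    ev (lmulXᵀ χ) (xPowY (suc l)) ∎
    where
    lmulXᵀ-at-0 : lmulXᵀ χ 0 l ≈ χ 0 (suc l)
    lmulXᵀ-at-0 = solve 4 (λ μ ν x y → con 1 :* x :+ μ :* con 0 :* y :+ ν :* con 0 :* y := x)
                          refl μ ν (χ 0 (suc l)) (χ 0 l)

  pow-+ : ∀ a i → pow q (a +ℕ i) ≈ pow q a * pow q i
  pow-+ zero i = sym (*-identityˡ _)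
  pow-+ (suc a) i = trans (*-congˡ (pow-+ a i)) (sym (*-assoc _ _ _))

  qint-+ : ∀ a i → qint (a +ℕ i) ≈ qint a + pow q a * qint i
  qint-+ a zero rewrite ℕ.+-identityʳ a =
    solve 2 (λ x p → x := x :+ p :* con 0) refl (qint a) (pow q a)
  qint-+ a (suc i) rewrite ℕ.+-suc a i =
    trans (+-cong (qint-+ a i) (pow-+ a i))
          (solve 4 (λ x p y z → (x :+ p :* y) :+ p :* z := x :+ p :* (y :+ z)) refl
                 (qint a) (pow q a) (qint i) (pow q i))

  -- pred (a + i) differs from pred a + i and a + pred i exactly when the
  -- corresponding q-integer [a]_q or [i]_q vanishes.
  qint-+-*-pred : ∀ (f : ℕ → Carrier) a i →
    qint (a +ℕ i) * f (pred (a +ℕ i))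
    ≈ pow q a * qint i * f (a +ℕ pred i) + qint a * f (pred a +ℕ i)
  qint-+-*-pred f zero i =
    solve 3 (λ x y z → x :* y := con 1 :* x :* y :+ con 0 :* z) refl (qint i) (f (pred i)) (f i)
  qint-+-*-pred f (suc a) zero rewrite ℕ.+-identityʳ a =
    solve 4 (λ x y p z → x :* y := p :* con 0 :* z :+ x :* y) refl
          (qint (suc a)) (f a) (pow q (suc a)) (f (suc a))
  qint-+-*-pred f (suc a) (suc i) = begin
    qint (suc a +ℕ suc i) * f (a +ℕ suc i)
      ≈⟨ *-congʳ (qint-+ (suc a) (suc i)) ⟩
    (qint (suc a) + pow q (suc a) * qint (suc i)) * f (a +ℕ suc i)
      ≈⟨ distribʳ (f (a +ℕ suc i)) _ _ ⟩
    qint (suc a) * f (a +ℕ suc i) + pow q (suc a) * qint (suc i) * f (a +ℕ suc i)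
      ≈⟨ +-comm _ _ ⟩
    pow q (suc a) * qint (suc i) * f (a +ℕ suc i) + qint (suc a) * f (a +ℕ suc i)
      ≡⟨ ≡.cong (λ t → pow q (suc a) * qint (suc i) * f t + qint (suc a) * f (a +ℕ suc i))
                (ℕ.+-suc a i) ⟩
    pow q (suc a) * qint (suc i) * f (suc a +ℕ i) + qint (suc a) * f (a +ℕ suc i) ∎

  -- Transpose of X Y^a = q^a Y^a X + μ [a]_q Y^(a-1) + ν [a]_q Y^a.
  shiftYᵀ-lmulXᵀ : ∀ a ψ → shiftYᵀ a (lmulXᵀ ψ)
    ≈ᶠ pow q a *ᶠ lmulXᵀ (shiftYᵀ a ψ) +ᶠ (μ * qint a) *ᶠ shiftYᵀ (pred a) ψ
       +ᶠ (ν * qint a) *ᶠ shiftYᵀ a ψ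
  shiftYᵀ-lmulXᵀ a ψ i m = begin
    pow q (a +ℕ i) * P + μ * qint (a +ℕ i) * ψ (pred (a +ℕ i)) m + ν * qint (a +ℕ i) * U
      ≈⟨ +-cong (+-cong (*-congʳ (pow-+ a i))
                        (trans (*-assoc μ _ _) (*-congˡ (qint-+-*-pred (λ t → ψ t m) a i))))
                (*-congʳ (*-congˡ (qint-+ a i))) ⟩
    pow q a * pow q i * P + μ * (pow q a * qint i * W + qint a * Z)
      + ν * (qint a + pow q a * qint i) * U
      ≈⟨ regroup (pow q a) (pow q i) P μ (qint i) W (qint a) Z ν U ⟩
    pow q a * (pow q i * P + μ * qint i * W + ν * qint i * U) + μ * qint a * Z + ν * qint a * U ∎
    where
    P = ψ (a +ℕ i) (suc m)
    U = ψ (a +ℕ i) m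
    W = ψ (a +ℕ pred i) m
    Z = ψ (pred a +ℕ i) m
    regroup : ∀ pa pi P m qi W qa Z n U →
      pa * pi * P + m * (pa * qi * W + qa * Z) + n * (qa + pa * qi) * U
      ≈ pa * (pi * P + m * qi * W + n * qi * U) + m * qa * Z + n * qa * U
    regroup = solve 10 (λ pa pi P m qi W qa Z n U →
      pa :* pi :* P :+ m :* (pa :* qi :* W :+ qa :* Z) :+ n :* (qa :+ pa :* qi) :* U
      := pa :* (pi :* P :+ m :* qi :* W :+ n :* qi :* U) :+ m :* qa :* Z :+ n :* qa :* U) refl

  mulYᵀ-lmulXᵀ : ∀ ψ → mulYᵀ (lmulXᵀ ψ) ≈ᶠ lmulXᵀ (mulYᵀ ψ)
  mulYᵀ-lmulXᵀ ψ a l = begin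
    ev (shiftYᵀ a (lmulXᵀ ψ)) xl
      ≈⟨ ev-cong (shiftYᵀ-lmulXᵀ a ψ) xl ⟩
    ev (pow q a *ᶠ lmulXᵀ (shiftYᵀ a ψ) +ᶠ (μ * qint a) *ᶠ shiftYᵀ (pred a) ψ
        +ᶠ (ν * qint a) *ᶠ shiftYᵀ a ψ) xl
      ≈⟨ trans (ev-+ᶠ _ _ xl) (+-congʳ (ev-+ᶠ _ _ xl)) ⟩
    ev (pow q a *ᶠ lmulXᵀ (shiftYᵀ a ψ)) xl + ev ((μ * qint a) *ᶠ shiftYᵀ (pred a) ψ) xl
      + ev ((ν * qint a) *ᶠ shiftYᵀ a ψ) xl
      ≈⟨ +-cong (+-cong (ev-*ᶠ _ _ xl) (ev-*ᶠ _ _ xl)) (ev-*ᶠ _ _ xl) ⟩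
    pow q a * ev (lmulXᵀ (shiftYᵀ a ψ)) xl + μ * qint a * mulYᵀ ψ (pred a) l
      + ν * qint a * mulYᵀ ψ a l
      ≈⟨ +-congʳ (+-congʳ (*-congˡ (ev-xPowY-suc l (shiftYᵀ a ψ)))) ⟨
    lmulXᵀ (mulYᵀ ψ) a l ∎
    where
    xl = xPowY l

  leftY²Xᵀ : Functional → Functional
  leftY²Xᵀ φ = lmulXᵀ (shiftYᵀ 2 φ)

  infix 4 _IsY²X·_

  _IsY²X·_ : Poly → Poly → Set (c ⊔ ℓ)
  p′ IsY²X· p = ∀ φ → ev φ p′ ≈ ev (leftY²Xᵀ φ) p

  isY²X·-step : ∀ {p′ p} x → p′ IsY²X· p → step p′ x IsY²X· step p x
  isY²X·-step {p′} {p} X h φ = begin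
    ev φ (mulX p′)              ≡⟨ ev-mulX φ p′ ⟩
    ev (mulXᵀ φ) p′             ≈⟨ h (mulXᵀ φ) ⟩
    ev (leftY²Xᵀ (mulXᵀ φ)) p   ≡⟨ ev-mulX (leftY²Xᵀ φ) p ⟨
    ev (leftY²Xᵀ φ) (mulX p)    ∎
  isY²X·-step {p′} {p} Y h φ = begin
    ev φ (mulY p′)              ≈⟨ ev-mulY φ p′ ⟩
    ev (mulYᵀ φ) p′             ≈⟨ h (mulYᵀ φ) ⟩
    ev (leftY²Xᵀ (mulYᵀ φ)) p   ≈⟨ ev-cong (mulYᵀ-lmulXᵀ (shiftYᵀ 2 φ)) p ⟨
    ev (mulYᵀ (leftY²Xᵀ φ)) p   ≈⟨ ev-mulY (leftY²Xᵀ φ) p ⟨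
    ev (leftY²Xᵀ φ) (mulY p)    ∎

  isY²X·-foldl : ∀ w {p′ p} → p′ IsY²X· p → foldl step p′ w IsY²X· foldl step p w
  isY²X·-foldl []      h = h
  isY²X·-foldl (x ∷ w) h = isY²X·-foldl w (isY²X·-step x h)

  nf-Y²X-isY²X·-nf-[] : nf (Y ∷ Y ∷ X ∷ []) IsY²X· nf []
  nf-Y²X-isY²X·-nf-[] φ = begin
    ev φ (mulX (mulY (mulY (nf []))))      ≡⟨ ev-mulX φ (mulY (mulY (nf []))) ⟩
    ev (mulXᵀ φ) (mulY (mulY (nf [])))     ≈⟨ ev-mulY (mulXᵀ φ) (mulY (nf [])) ⟩
    ev (mulYᵀ (mulXᵀ φ)) (mulY (nf []))    ≈⟨ ev-mulY (mulYᵀ (mulXᵀ φ)) (nf []) ⟩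
    ev (mulYᵀ (mulYᵀ (mulXᵀ φ))) (nf [])   ≈⟨ normalise μ ν (φ 2 1) (φ 2 0) ⟩
    ev (leftY²Xᵀ φ) (nf [])                ∎
    where
    normalise : ∀ m n x y → 1# * (1# * (1# * x + 0#) + 0#) + 0#
                            ≈ 1# * (1# * x + m * 0# * y + n * 0# * y) + 0#
    normalise = solve 4 (λ m n x y →
      con 1 :* (con 1 :* (con 1 :* x :+ con 0) :+ con 0) :+ con 0
      := con 1 :* (con 1 :* x :+ m :* con 0 :* y :+ n :* con 0 :* y) :+ con 0) refl

  ev-nf-Y²X∷ : ∀ w φ → ev φ (nf (Y ∷ Y ∷ X ∷ w)) ≈ ev (leftY²Xᵀ φ) (nf w)
  ev-nf-Y²X∷ w = isY²X·-foldl w nf-Y²X-isY²X·-nf-[]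

  δ : ℕ → ℕ → Functional
  δ j k a l = if (a ≡ᵇ j) ∧ (l ≡ᵇ k) then 1# else 0#

  δℤ : ℤ → ℤ → Functional
  δℤ (+ j)      (+ k)    = δ j k
  δℤ (+ j)      -[1+ k ] = 0ᶠ
  δℤ -[1+ j ]   k        = 0ᶠ

  coeff-ev : ∀ p j k → coeff p j k ≈ ev (δ j k) p
  coeff-ev [] j k = refl
  coeff-ev ((b , a , l) ∷ p) j k with (a ≡ᵇ j) ∧ (l ≡ᵇ k)
  ... | true  = +-cong (sym (*-identityʳ b)) (coeff-ev p j k)
  ... | false = trans (coeff-ev p j k) (sym (trans (+-congʳ (zeroʳ b)) (+-identityˡ _)))

  Lℤ-ev : ∀ n j k → Lℤ n j k ≈ ev (δℤ j k) (nf (word n))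
  Lℤ-ev n (+ j)    (+ k)    = coeff-ev (nf (word n)) j k
  Lℤ-ev n (+ j)    -[1+ k ] = sym (ev-0ᶠ (nf (word n)))
  Lℤ-ev n -[1+ j ] k        = sym (ev-0ᶠ (nf (word n)))

  δ-sel : ∀ (f : ℕ → Carrier) j k a l → f a * δ j k a l ≈ f j * δ j k a l
  δ-sel f j k a l with a ≡ᵇ j in a≡ᵇj
  ... | true  = *-congʳ (reflexive (≡.cong f (ℕ.≡ᵇ⇒≡ a j (≡.subst T (≡.sym a≡ᵇj) _))))
  ... | false = trans (zeroʳ _) (sym (zeroʳ _))

  mulXᵀ-δ : ∀ j k → mulXᵀ (δ j k) ≈ᶠ δℤ (+ j) (k ⊖ 1)
  mulXᵀ-δ j zero a l with a ≡ᵇ j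
  ... | true  = refl
  ... | false = refl
  mulXᵀ-δ j (suc k) a l = refl

  leftY²Xᵀ-δ : ∀ i k → leftY²Xᵀ (δ (2 +ℕ i) k)
    ≈ᶠ pow q i *ᶠ δℤ (+ i) (k ⊖ 1) +ᶠ (μ * qint (suc i)) *ᶠ δ (suc i) k
       +ᶠ (ν * qint i) *ᶠ δ i k
  leftY²Xᵀ-δ i k a l =
    +-cong (+-cong (trans (δ-sel (pow q) i k a (suc l)) (*-congˡ (mulXᵀ-δ i k a l)))
                   (μ-term a))
           (δ-sel (λ t → ν * qint t) i k a l)
    where
    μ-term : ∀ a → μ * qint a * δ (2 +ℕ i) k (2 +ℕ pred a) l
                   ≈ μ * qint (suc i) * δ (suc i) k a l
    μ-term zero    = trans (trans (*-congʳ (zeroʳ μ)) (zeroˡ _)) (sym (zeroʳ _))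
    μ-term (suc a) = δ-sel (λ t → μ * qint (suc t)) i k a l

  L-recurrence : ∀ n i k →
    L (suc n) (2 +ℕ i) k
    ≈ pow q i * Lℤ n (+ i) (k ⊖ 1) + μ * qint (suc i) * L n (suc i) k + ν * qint i * L n i k
  L-recurrence n i k = begin
    L (suc n) (2 +ℕ i) k
      ≈⟨ coeff-ev (nf (word (suc n))) (2 +ℕ i) k ⟩
    ev (δ (2 +ℕ i) k) (nf (word (suc n)))
      ≈⟨ ev-nf-Y²X∷ (word n) (δ (2 +ℕ i) k) ⟩
    ev (leftY²Xᵀ (δ (2 +ℕ i) k)) p
      ≈⟨ ev-cong (leftY²Xᵀ-δ i k) p ⟩
    ev (pow q i *ᶠ δℤ (+ i) (k ⊖ 1) +ᶠ (μ * qint (suc i)) *ᶠ δ (suc i) k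
        +ᶠ (ν * qint i) *ᶠ δ i k) p
      ≈⟨ trans (ev-+ᶠ _ _ p) (+-congʳ (ev-+ᶠ _ _ p)) ⟩
    ev (pow q i *ᶠ δℤ (+ i) (k ⊖ 1)) p + ev ((μ * qint (suc i)) *ᶠ δ (suc i) k) p
      + ev ((ν * qint i) *ᶠ δ i k) p
      ≈⟨ +-cong (+-cong (coefficient (pow q i) (+ i) (k ⊖ 1))
                        (coefficient (μ * qint (suc i)) (+ suc i) (+ k)))
                (coefficient (ν * qint i) (+ i) (+ k)) ⟩
    pow q i * Lℤ n (+ i) (k ⊖ 1) + μ * qint (suc i) * L n (suc i) k + ν * qint i * L n i k ∎
    where
    p = nf (word n)
    coefficient : ∀ a j k → ev (a *ᶠ δℤ j k) p ≈ a * Lℤ n j k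
    coefficient a j k = trans (ev-*ᶠ a (δℤ j k) p) (*-congˡ (sym (Lℤ-ev n j k)))

proposition2p15 : ∀ {c ℓ} (R : CommutativeRing c ℓ) (μ ν q : CommutativeRing.Carrier R)
    (n j k : ℕ) → 2 ≤ j →
    let open CommutativeRing R
        open Normal R μ ν q
    in Lℤ (suc n) (j ⊖ 0) (k ⊖ 0)
       ≈ pow q (j ∸ 2) * Lℤ n (j ⊖ 2) (k ⊖ 1)
         + μ * qint (j ∸ 1) * Lℤ n (j ⊖ 1) (k ⊖ 0)
         + ν * qint (j ∸ 2) * Lℤ n (j ⊖ 2) (k ⊖ 0)
proposition2p15 R μ ν q n (suc (suc i)) k (s≤s (s≤s z≤n)) =
  NormalOrderingDuality.L-recurrence R μ ν q n i k
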